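{- For every integer $n\geq 1$ there exists a connected graph $G$ with $n$ vertices such that $b_{\mathsf{fa}}(G)=\lceil\log_2 n\rceil$, i.e., there is a collection of lists $(\ell_v)_{v\in V(G)}$ such that, in the fully-adaptive source-oblivious model, broadcast from every source vertex completes in $\lceil\log_2 n\rceil$ rounds. In particular, for every $n\geq 1$, the complete graph $K_n$ satisfies $b_{\mathsf{fa}}(K_n)=\lceil\log_2 n\rceil$.
   Context: Broadcasting in a connected graph $G$: initially only a source vertex $s$ holds a message; time proceeds in synchronous rounds, and in each round every informed vertex may transmit the message to at most one of its neighbors. Fully-adaptive source-oblivious model: each vertex $v$ is assigned a single ordered list $\ell_v=(u_1,\dots,u_k)$ of distinct neighbors of $v$ (independent of the source). Once $v$ is informed, in each subsequent round it sends the message to the first vertex of $\ell_v$ that is not already informed at the start of that round (informed neighbors are skipped, since every vertex is aware which of its neighbors are informed); $v$ stops when all vertices in its list are informed. For a family of lists $L=(\ell_v)_{v\in V(G)}$ and a source $s$, $b_{\mathsf{fa}}(G,s,L)$ denotes the number of rounds until all vertices are informed, and $b_{\mathsf{fa}}(G)=\min_L\max_{s\in V(G)} b_{\mathsf{fa}}(G,s,L)$. -}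

module Defs where

open import Data.Nat using (ℕ; zero; suc; _<_)
open import Data.Fin using (Fin; _≟_)
open import Data.Bool using (Bool; true; false; _∨_; _∧_; not)
open import Data.List using (List; []; _∷_)
open import Data.Bool.ListAction using (any)
open import Data.List.Relation.Unary.All using (All)
open import Data.List.Relation.Unary.Unique.Propositional using (Unique)
open import Data.Maybe using (Maybe; just; nothing)
open import Data.Fin.Base using (toℕ)
open import Data.List.Base using (allFin)
open import Data.Product using (Σ; _×_; ∃)
open import Relation.Nullary using (¬_)
open import Relation.Nullary.Decidable using (⌊_⌋)
open import Relation.Binary.PropositionalEquality using (_≡_)

record Graph (n : ℕ) : Set where
  field
    adj    : Fin n → Fin n → Bool
    adj-sym    : ∀ u v → adj u v ≡ adj v u
    adj-irrefl : ∀ v → adj v v ≡ false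
open Graph public

data Reach {n : ℕ} (G : Graph n) : Fin n → Fin n → Set where
  here : ∀ {v} → Reach G v v
  step : ∀ {u w v} → adj G u w ≡ true → Reach G w v → Reach G u v

Connected : ∀ {n} → Graph n → Set
Connected {n} G = ∀ (u v : Fin n) → Reach G u v

complete : (n : ℕ) → Graph n
complete n = record
  { adj = λ u v → not ⌊ u ≟ v ⌋
  ; adj-sym = symK
  ; adj-irrefl = irrK }
  where
  open import Relation.Binary.PropositionalEquality using (refl) renaming (sym to ≡-sym)
  open import Relation.Nullary using (yes; no)
  symK : ∀ u v → not ⌊ u ≟ v ⌋ ≡ not ⌊ v ≟ u ⌋
  symK u v with u ≟ v | v ≟ u
  ... | yes _ | yes _ = refl
  ... | no _  | no _  = refl
  ... | yes p | no q  = Data.Empty.⊥-elim (q (≡-sym p))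
    where import Data.Empty
  ... | no p  | yes q = Data.Empty.⊥-elim (p (≡-sym q))
    where import Data.Empty
  irrK : ∀ v → not ⌊ v ≟ v ⌋ ≡ false
  irrK v with v ≟ v
  ... | yes _ = refl
  ... | no ¬p = Data.Empty.⊥-elim (¬p refl)
    where import Data.Empty

Lists : ℕ → Set
Lists n = Fin n → List (Fin n)

ValidLists : ∀ {n} → Graph n → Lists n → Set
ValidLists G L = ∀ v → Unique (L v) × All (λ u → adj G v u ≡ true) (L v)

Informed : ℕ → Set
Informed n = Fin n → Bool

firstUninformed : ∀ {n} → Informed n → List (Fin n) → Maybe (Fin n)
firstUninformed I []       = nothing
firstUninformed I (u ∷ us) with I u
... | true  = firstUninformed I us
... | false = just u

sends : ∀ {n} → Informed n → List (Fin n) → Fin n → Bool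
sends I ℓ w with firstUninformed I ℓ
... | nothing = false
... | just u  = ⌊ u ≟ w ⌋

-- One synchronous round of the fully-adaptive model: every vertex informed at
-- the start of the round sends to the first uninformed vertex of its list.
round : ∀ {n} → Lists n → Informed n → Informed n
round {n} L I w = I w ∨ any (λ v → I v ∧ sends I (L v) w) (allFin n)

informedAfter : ∀ {n} → Lists n → Fin n → ℕ → Informed n
informedAfter L s zero    = λ w → ⌊ w ≟ s ⌋
informedAfter L s (suc t) = round L (informedAfter L s t)

DoneAfter : ∀ {n} → Lists n → Fin n → ℕ → Set
DoneAfter {n} L s t = ∀ (w : Fin n) → informedAfter L s t w ≡ true

-- This is exactly
-- min_L max_s b_fa(G,s,L) = k, with b_fa(G,s,L) the least t with DoneAfter.
BroadcastTimeFA : ∀ {n} → Graph n → ℕ → Set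
BroadcastTimeFA {n} G k =
  (Σ (Lists n) λ L → ValidLists G L × (∀ s → DoneAfter L s k))
  × (∀ (L : Lists n) → ValidLists G L →
       ∃ λ (s : Fin n) → ∀ t → t < k → ¬ DoneAfter L s t)

-- Lower bound: in one round every informed vertex informs at most one new vertex, so the
-- informed set at most doubles and t rounds reach at most 2^t vertices.
-- Upper bound: embed K_n into the hypercube {0,1}^K with K = ⌈log₂ n⌉ (vertex u becomes the
-- binary expansion of u) and give each vertex its cube neighbours in increasing order,
-- dropping those outside K_n.  From a source whose top bit is 1, the first round informs the
-- partner across the top bit and the two subcubes then broadcast independently; from a source
-- whose top bit is 0, the lower subcube is finished within K - 1 rounds, after which every
-- vertex sends across the top bit, since it lists that neighbour last.
module Submission where

open import Defs
open import Algebra.Properties.CommutativeSemigroup using (interchange)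
open import Data.Bool using (Bool; true; false; _∨_; _∧_; not)
open import Data.Bool.Properties using (T-≡)
open import Data.Bool.ListAction using (any; or)
open import Data.Fin using (Fin; zero; suc; toℕ; fromℕ<; _≟_)
open import Data.Fin.Properties as Fin using (toℕ<n; toℕ-fromℕ<; toℕ-injective)
open import Data.List using (List; []; _∷_; _++_; [_]; map; mapMaybe; allFin)
open import Data.List.Properties using (map-++; ++-assoc; mapMaybe-++; map-tabulate)
open import Data.List.Membership.Propositional using (lose)
open import Data.List.Membership.Propositional.Properties using (∈-allFin)
open import Data.List.Relation.Unary.All as All using (All; []; _∷_)
import Data.List.Relation.Unary.All.Properties as All
open import Data.List.Relation.Unary.Any.Properties using (any⁺)
open import Data.List.Relation.Unary.AllPairs using ([]; _∷_)
import Data.List.Relation.Unary.AllPairs.Properties as AllPairs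
open import Data.List.Relation.Unary.Unique.Propositional using (Unique)
import Data.List.Relation.Unary.Unique.Propositional.Properties as Unique
open import Data.Maybe using (Maybe; just; nothing)
import Data.Maybe.Relation.Unary.All as Maybe
open import Data.Nat using (ℕ; zero; suc; _+_; _∸_; _^_; _⊔_; _≤_; _<_; _≥_; z≤n; s≤s; _<?_; ⌊_/2⌋; ⌈_/2⌉)
open import Data.Nat.Properties hiding (_≟_)
open import Data.Nat.Logarithm using (⌈log₂_⌉; ⌈log₂⌉-mono-≤; ⌈log₂2^n⌉≡n)
open import Data.Nat.Logarithm.Core using (⌈log2⌉)
open import Data.Nat.Induction using (<-wellFounded)
open import Data.Product using (Σ; _×_; _,_)
open import Data.Sum using (_⊎_; inj₁; inj₂)
open import Data.Unit using (⊤; tt)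
open import Data.Empty using (⊥-elim)
open import Data.Vec using (Vec; []; _∷_)
open import Data.Vec.Properties using (∷-injectiveʳ)
open import Function using (_∘_)
open import Function.Bundles using (Equivalence)
open import Induction.WellFounded using (Acc; acc)
open import Relation.Nullary using (yes; no)
open import Relation.Nullary.Decidable using (⌊_⌋; isYes≗does; dec-true; dec-false)
open import Relation.Binary.PropositionalEquality hiding ([_])

≟-sound : ∀ {n} {u w : Fin n} → ⌊ u ≟ w ⌋ ≡ true → u ≡ w
≟-sound {u = u} {w} eq with u ≟ w
≟-sound eq | yes u≡w = u≡w
≟-sound () | no  _

≟-complete : ∀ {n} {u w : Fin n} → u ≡ w → ⌊ u ≟ w ⌋ ≡ true
≟-complete {u = u} {w} u≡w = trans (isYes≗does (u ≟ w)) (dec-true (u ≟ w) u≡w)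

≟-≢ : ∀ {n} {u w : Fin n} → u ≢ w → ⌊ u ≟ w ⌋ ≡ false
≟-≢ {u = u} {w} u≢w = trans (isYes≗does (u ≟ w)) (dec-false (u ≟ w) u≢w)

-- Counting informed vertices

𝟙 : Bool → ℕ
𝟙 true  = 1
𝟙 false = 0

count : ∀ {n} → (Fin n → Bool) → ℕ
count {zero}  f = 0
count {suc n} f = 𝟙 (f zero) + count (f ∘ suc)

count-cong : ∀ {n} {f g : Fin n → Bool} → (∀ w → f w ≡ g w) → count f ≡ count g
count-cong {zero}  f≗g = refl
count-cong {suc n} f≗g = cong₂ _+_ (cong 𝟙 (f≗g zero)) (count-cong (f≗g ∘ suc))

count-false : ∀ n → count {n} (λ _ → false) ≡ 0
count-false zero    = refl
count-false (suc n) = count-false n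

count-true : ∀ {n} {f : Fin n → Bool} → (∀ w → f w ≡ true) → count f ≡ n
count-true {zero}  f≡true = refl
count-true {suc n} f≡true rewrite f≡true zero = cong suc (count-true (f≡true ∘ suc))

𝟙-∨ : ∀ a b → 𝟙 (a ∨ b) ≤ 𝟙 a + 𝟙 b
𝟙-∨ true  b = s≤s z≤n
𝟙-∨ false b = ≤-refl

count-∨ : ∀ {n} (f g : Fin n → Bool) → count (λ w → f w ∨ g w) ≤ count f + count g
count-∨ {zero}  f g = z≤n
count-∨ {suc n} f g = begin
  𝟙 (f zero ∨ g zero) + count (λ w → f (suc w) ∨ g (suc w))
    ≤⟨ +-mono-≤ (𝟙-∨ (f zero) (g zero)) (count-∨ (f ∘ suc) (g ∘ suc)) ⟩
  (𝟙 (f zero) + 𝟙 (g zero)) + (count (f ∘ suc) + count (g ∘ suc))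
    ≡⟨ interchange +-commutativeSemigroup (𝟙 (f zero)) _ _ _ ⟩
  count f + count g ∎
  where open ≤-Reasoning

count-≤1 : ∀ {n} (f : Fin n → Bool) →
  (∀ {u w} → f u ≡ true → f w ≡ true → u ≡ w) → count f ≤ 1
count-≤1 {zero}  f unique = z≤n
count-≤1 {suc n} f unique with f zero in f0
... | true  = ≤-reflexive (cong suc (trans (count-cong rest-false) (count-false n)))
  where
  rest-false : ∀ w → f (suc w) ≡ false
  rest-false w with f (suc w) in fw
  ... | false = refl
  ... | true  with () ← unique f0 fw
... | false = count-≤1 (f ∘ suc) (λ fu fw → Fin.suc-injective (unique fu fw))

any-allFin-suc : ∀ {k} (p : Fin (suc k) → Bool) →
  any p (allFin (suc k)) ≡ p zero ∨ any (p ∘ suc) (allFin k)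
any-allFin-suc p = cong (λ bs → p zero ∨ or bs)
  (trans (map-tabulate suc p) (sym (map-tabulate (λ i → i) (p ∘ suc))))

count-⋃ : ∀ {k m} (S : Fin k → Fin m → Bool) (I : Fin k → Bool) →
  (∀ v → count (S v) ≤ 𝟙 (I v)) → count (λ w → any (λ v → S v w) (allFin k)) ≤ count I
count-⋃ {zero}  {m} S I bound = ≤-reflexive (count-false m)
count-⋃ {suc k}     S I bound = begin
  count (λ w → any (λ v → S v w) (allFin (suc k)))
    ≡⟨ count-cong (λ w → any-allFin-suc (λ v → S v w)) ⟩
  count (λ w → S zero w ∨ any (λ v → S (suc v) w) (allFin k))
    ≤⟨ count-∨ (S zero) _ ⟩
  count (S zero) + count (λ w → any (λ v → S (suc v) w) (allFin k))
    ≤⟨ +-mono-≤ (bound zero) (count-⋃ (S ∘ suc) (I ∘ suc) (bound ∘ suc)) ⟩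
  count I ∎
  where open ≤-Reasoning

sends-functional : ∀ {n} (I : Informed n) (ℓ : List (Fin n)) {u w : Fin n} →
  sends I ℓ u ≡ true → sends I ℓ w ≡ true → u ≡ w
sends-functional I ℓ to-u to-w with firstUninformed I ℓ
sends-functional I ℓ ()   to-w | nothing
sends-functional I ℓ to-u to-w | just x = trans (sym (≟-sound to-u)) (≟-sound to-w)

count-sent : ∀ {n} (I : Informed n) (ℓ : List (Fin n)) (v : Fin n) →
  count (λ w → I v ∧ sends I ℓ w) ≤ 𝟙 (I v)
count-sent {n} I ℓ v with I v
... | false = ≤-reflexive (count-false n)
... | true  = count-≤1 (sends I ℓ) (sends-functional I ℓ)

count-round : ∀ {n} (L : Lists n) (I : Informed n) → count (round L I) ≤ count I + count I
count-round {n} L I = begin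
  count (round L I)
    ≤⟨ count-∨ I _ ⟩
  count I + count (λ w → any (λ v → I v ∧ sends I (L v) w) (allFin n))
    ≤⟨ +-monoʳ-≤ (count I) (count-⋃ (λ v w → I v ∧ sends I (L v) w) I (λ v → count-sent I (L v) v)) ⟩
  count I + count I ∎
  where open ≤-Reasoning

count-informedAfter : ∀ {n} (L : Lists n) (s : Fin n) t → count (informedAfter L s t) ≤ 2 ^ t
count-informedAfter L s zero    =
  count-≤1 (informedAfter L s zero) (λ u≡s w≡s → trans (≟-sound u≡s) (sym (≟-sound w≡s)))
count-informedAfter L s (suc t) = begin
  count (informedAfter L s (suc t))
    ≤⟨ count-round L (informedAfter L s t) ⟩
  count (informedAfter L s t) + count (informedAfter L s t)
    ≤⟨ +-mono-≤ (count-informedAfter L s t) (count-informedAfter L s t) ⟩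
  2 ^ t + 2 ^ t
    ≡⟨ cong (2 ^ t +_) (sym (+-identityʳ (2 ^ t))) ⟩
  2 ^ suc t ∎
  where open ≤-Reasoning

DoneAfter⇒⌈log₂⌉≤ : ∀ {n} (L : Lists n) (s : Fin n) t → DoneAfter L s t → ⌈log₂ n ⌉ ≤ t
DoneAfter⇒⌈log₂⌉≤ {n} L s t done = begin
  ⌈log₂ n ⌉         ≤⟨ ⌈log₂⌉-mono-≤ n≤2^t ⟩
  ⌈log₂ (2 ^ t) ⌉   ≡⟨ ⌈log₂2^n⌉≡n t ⟩
  t                 ∎
  where
  open ≤-Reasoning
  n≤2^t : n ≤ 2 ^ t
  n≤2^t = subst (_≤ 2 ^ t) (count-true done) (count-informedAfter L s t)

firstUninformed-++ : ∀ {n} (I : Informed n) (pre rest : List (Fin n)) →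
  All (λ y → I y ≡ true) pre → firstUninformed I (pre ++ rest) ≡ firstUninformed I rest
firstUninformed-++ I []       rest []           = refl
firstUninformed-++ I (y ∷ ys) rest (Iy ∷ Iys) with I y
... | true = firstUninformed-++ I ys rest Iys

firstUninformed-∷ : ∀ {n} (I : Informed n) {u : Fin n} (rest : List (Fin n)) →
  I u ≡ false → firstUninformed I (u ∷ rest) ≡ just u
firstUninformed-∷ I rest Iu rewrite Iu = refl

sends-firstUninformed : ∀ {n} (I : Informed n) (ℓ : List (Fin n)) {u : Fin n} →
  firstUninformed I ℓ ≡ just u → sends I ℓ u ≡ true
sends-firstUninformed I ℓ first with firstUninformed I ℓ
sends-firstUninformed I ℓ refl | just u = ≟-complete refl

round-keeps : ∀ {n} (L : Lists n) (I : Informed n) {w} → I w ≡ true → round L I w ≡ true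
round-keeps {n} L I {w} Iw = cong (_∨ any (λ v → I v ∧ sends I (L v) w) (allFin n)) Iw

round-sends : ∀ {n} (L : Lists n) (I : Informed n) {v u : Fin n} (pre post : List (Fin n)) →
  I v ≡ true → L v ≡ pre ++ u ∷ post → All (λ y → I y ≡ true) pre → round L I u ≡ true
round-sends L I {v} {u} pre post Iv split Ipre with I u in Iu
... | true  = refl
... | false = Equivalence.to T-≡ (any⁺ _ (lose (∈-allFin v) (Equivalence.from T-≡ v-sends-u)))
  where
  first : firstUninformed I (L v) ≡ just u
  first = begin
    firstUninformed I (L v)               ≡⟨ cong (firstUninformed I) split ⟩
    firstUninformed I (pre ++ u ∷ post)   ≡⟨ firstUninformed-++ I pre (u ∷ post) Ipre ⟩
    firstUninformed I (u ∷ post)          ≡⟨ firstUninformed-∷ I post Iu ⟩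
    just u                                ∎
    where open ≡-Reasoning
  v-sends-u : (I v ∧ sends I (L v) u) ≡ true
  v-sends-u rewrite Iv = sends-firstUninformed I (L v) first

-- The binary cube

Cube : ℕ → Set
Cube = Vec Bool

value : ∀ {K} → Cube K → ℕ
value []                  = 0
value (false ∷ x)         = value x
value {suc K} (true ∷ x)  = 2 ^ K + value x

value< : ∀ {K} (x : Cube K) → value x < 2 ^ K
value< []                 = s≤s z≤n
value< {suc K} (false ∷ x) = ≤-trans (value< x) (m≤m+n (2 ^ K) _)
value< {suc K} (true ∷ x)  = begin-strict
  2 ^ K + value x   <⟨ +-monoʳ-< (2 ^ K) (value< x) ⟩
  2 ^ K + 2 ^ K     ≡⟨ cong (2 ^ K +_) (sym (+-identityʳ (2 ^ K))) ⟩
  2 ^ suc K         ∎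
  where open ≤-Reasoning

bits : ∀ K → ℕ → Cube K
bits zero    m = []
bits (suc K) m with m <? 2 ^ K
... | yes _ = false ∷ bits K m
... | no  _ = true  ∷ bits K (m ∸ 2 ^ K)

value-bits : ∀ K m → m < 2 ^ K → value (bits K m) ≡ m
value-bits zero    zero    _         = refl
value-bits zero    (suc m) (s≤s ())
value-bits (suc K) m m<2^K+1 with m <? 2 ^ K
... | yes m<2^K = value-bits K m m<2^K
... | no  m≮2^K = begin
  2 ^ K + value (bits K (m ∸ 2 ^ K))   ≡⟨ cong (2 ^ K +_) (value-bits K (m ∸ 2 ^ K) m∸2^K<2^K) ⟩
  2 ^ K + (m ∸ 2 ^ K)                 ≡⟨ m+[n∸m]≡n (≮⇒≥ m≮2^K) ⟩
  m                                   ∎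
  where
  open ≡-Reasoning
  m∸2^K<2^K : m ∸ 2 ^ K < 2 ^ K
  m∸2^K<2^K = m<n+o⇒m∸n<o m (2 ^ K) {{m^n≢0 2 K}}
    (subst (m <_) (cong (2 ^ K +_) (+-identityʳ (2 ^ K))) m<2^K+1)

bits-value : ∀ {K} (x : Cube K) → bits K (value x) ≡ x
bits-value []                  = refl
bits-value {suc K} (false ∷ x) with value x <? 2 ^ K
... | yes _        = cong (false ∷_) (bits-value x)
... | no  x≮2^K    = ⊥-elim (x≮2^K (value< x))
bits-value {suc K} (true ∷ x)  with 2 ^ K + value x <? 2 ^ K
... | yes too-small = ⊥-elim (m+n≮m (2 ^ K) (value x) too-small)
... | no  _         = cong (true ∷_) (trans (cong (bits K) (m+n∸m≡n (2 ^ K) (value x))) (bits-value x))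

-- In increasing order of value.
neighbours : ∀ {K} → Cube K → List (Cube K)
neighbours []          = []
neighbours (false ∷ x) = map (false ∷_) (neighbours x) ++ [ true ∷ x ]
neighbours (true ∷ x)  = (false ∷ x) ∷ map (true ∷_) (neighbours x)

neighbours-unique : ∀ {K} (x : Cube K) → Unique (neighbours x)
neighbours-unique []          = []
neighbours-unique (false ∷ x) =
  AllPairs.++⁺ (Unique.map⁺ ∷-injectiveʳ (neighbours-unique x)) ([] ∷ [])
    (All.map⁺ (All.universal (λ _ → (λ ()) ∷ []) (neighbours x)))
neighbours-unique (true ∷ x)  =
  All.map⁺ (All.universal (λ _ → λ ()) (neighbours x)) ∷ Unique.map⁺ ∷-injectiveʳ (neighbours-unique x)

neighbours-irreflexive : ∀ {K} (x : Cube K) → All (x ≢_) (neighbours x)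
neighbours-irreflexive []          = []
neighbours-irreflexive (false ∷ x) =
  All.++⁺ (All.map⁺ (All.map (λ x≢y → x≢y ∘ ∷-injectiveʳ) (neighbours-irreflexive x))) ((λ ()) ∷ [])
neighbours-irreflexive (true ∷ x)  =
  (λ ()) ∷ All.map⁺ (All.map (λ x≢y → x≢y ∘ ∷-injectiveʳ) (neighbours-irreflexive x))

-- The broadcast schedule on the cube

-- Vertices certainly informed t rounds after s starts broadcasting with the lists `neighbours`.
Reached : ∀ {K} → Cube K → Cube K → ℕ → Set
Reached s           x       zero    = x ≡ s
Reached []          []      (suc t) = ⊤
Reached {suc K} (false ∷ s) (c ∷ x) (suc t) = (c ≡ false × Reached s x (suc t)) ⊎ K ≤ t
Reached (true ∷ s)  (c ∷ x) (suc t) = Reached s x t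

Reached-all : ∀ {K} (s x : Cube K) t → K ≤ t → Reached s x t
Reached-all []          []      zero    _         = refl
Reached-all []          []      (suc t) _         = tt
Reached-all (false ∷ s) (c ∷ x) (suc t) (s≤s K≤t) = inj₂ K≤t
Reached-all (true ∷ s)  (c ∷ x) (suc t) (s≤s K≤t) = Reached-all s x t K≤t

Reached-lower : ∀ {K} {s x : Cube K} t → Reached s x t → Reached (false ∷ s) (false ∷ x) t
Reached-lower zero    x≡s = cong (false ∷_) x≡s
Reached-lower (suc t) r   = inj₁ (refl , r)

-- Why x is informed in round t + 1; the bound keeps the sender inside K_n whenever s and x are.
record Sender {K} (s x : Cube K) (t : ℕ) : Set where
  field
    sender           : Cube K
    sender-reached   : Reached s sender t
    sender-bounded   : value sender ≤ value s ⊔ value x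
    before after     : List (Cube K)
    neighbours-split : neighbours sender ≡ before ++ x ∷ after
    before-reached   : All (λ y → Reached s y t) before

map-split : ∀ {A B : Set} (f : A → B) (pre : List A) (x : A) (post : List A) (rest : List B) →
  map f (pre ++ x ∷ post) ++ rest ≡ map f pre ++ f x ∷ (map f post ++ rest)
map-split f pre x post rest = begin
  map f (pre ++ x ∷ post) ++ rest            ≡⟨ cong (_++ rest) (map-++ f pre (x ∷ post)) ⟩
  (map f pre ++ f x ∷ map f post) ++ rest    ≡⟨ ++-assoc (map f pre) _ rest ⟩
  map f pre ++ f x ∷ (map f post ++ rest)    ∎
  where open ≡-Reasoning

Sender-lower : ∀ {K} {s x : Cube K} {t} (s′ : Cube (suc K)) t′ → value s ≤ value s′ →
  (∀ {y} → Reached s y t → Reached s′ (false ∷ y) t′) →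
  Sender s x t → Sender s′ (false ∷ x) t′
Sender-lower {x = x} s′ t′ s≤s′ lift σ = record
  { sender           = false ∷ sender
  ; sender-reached   = lift sender-reached
  ; sender-bounded   = ≤-trans sender-bounded (⊔-monoˡ-≤ (value x) s≤s′)
  ; before           = map (false ∷_) before
  ; after            = map (false ∷_) after ++ [ true ∷ sender ]
  ; neighbours-split = trans (cong (λ ys → map (false ∷_) ys ++ [ true ∷ sender ]) neighbours-split)
                             (map-split (false ∷_) before x after [ true ∷ sender ])
  ; before-reached   = All.map⁺ (All.map lift before-reached)
  }
  where open Sender σ

Sender-upper : ∀ {K} {s x : Cube K} {t} → Sender s x t → Sender (true ∷ s) (true ∷ x) (suc t)
Sender-upper {K} {s} {x} σ = record
  { sender           = true ∷ sender
  ; sender-reached   = sender-reached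
  ; sender-bounded   = ≤-trans (+-monoʳ-≤ (2 ^ K) sender-bounded)
                               (≤-reflexive (+-distribˡ-⊔ (2 ^ K) (value s) (value x)))
  ; before           = (false ∷ sender) ∷ map (true ∷_) before
  ; after            = map (true ∷_) after
  ; neighbours-split = cong ((false ∷ sender) ∷_)
                            (trans (cong (map (true ∷_)) neighbours-split) (map-++ (true ∷_) before (x ∷ after)))
  ; before-reached   = sender-reached ∷ All.map⁺ before-reached
  }
  where open Sender σ

Reached-step : ∀ {K} (s x : Cube K) t → Reached s x (suc t) → Reached s x t ⊎ Sender s x t
Reached-step []          []      t _ = inj₁ (Reached-all [] [] t z≤n)
Reached-step (false ∷ s) (c ∷ x) t (inj₁ (refl , r)) with Reached-step s x t r
... | inj₁ r′ = inj₁ (Reached-lower t r′)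
... | inj₂ σ  = inj₂ (Sender-lower (false ∷ s) t ≤-refl (Reached-lower t) σ)
Reached-step (false ∷ s) (false ∷ x) t (inj₂ K≤t) = inj₁ (Reached-lower t (Reached-all s x t K≤t))
Reached-step {suc K} (false ∷ s) (true ∷ x) t (inj₂ K≤t) = inj₂ record
  { sender           = false ∷ x
  ; sender-reached   = Reached-lower t (Reached-all s x t K≤t)
  ; sender-bounded   = ≤-trans (m≤n+m (value x) (2 ^ K)) (m≤n⊔m (value s) _)
  ; before           = map (false ∷_) (neighbours x)
  ; after            = []
  ; neighbours-split = refl
  ; before-reached   = All.map⁺ (All.universal (λ y → Reached-lower t (Reached-all s y t K≤t)) _)
  }
Reached-step (true ∷ s) (true ∷ .s)  zero refl = inj₁ refl
Reached-step (true ∷ s) (false ∷ .s) zero refl = inj₂ record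
  { sender           = true ∷ s
  ; sender-reached   = refl
  ; sender-bounded   = m≤m⊔n _ _
  ; before           = []
  ; after            = map (true ∷_) (neighbours s)
  ; neighbours-split = refl
  ; before-reached   = []
  }
Reached-step (true ∷ s) (c ∷ x) (suc t) r with Reached-step s x t r
... | inj₁ r′ = inj₁ r′
Reached-step (true ∷ s) (true ∷ x) (suc t) r | inj₂ σ = inj₂ (Sender-upper σ)
Reached-step {suc K} (true ∷ s) (false ∷ x) (suc t) r | inj₂ σ =
  inj₂ (Sender-lower (true ∷ s) (suc t) (m≤n+m (value s) (2 ^ K)) (λ r′ → r′) σ)

-- Transfer to K_n

-- Follows the recursion ⌈log2⌉ (2 + k) = 1 + ⌈log2⌉ (1 + ⌈ k /2⌉) defining the logarithm.
n≤2^⌈log2⌉ : ∀ n (rec : Acc _<_ n) → n ≤ 2 ^ ⌈log2⌉ n rec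
n≤2^⌈log2⌉ zero                _         = z≤n
n≤2^⌈log2⌉ (suc zero)          _         = s≤s z≤n
n≤2^⌈log2⌉ (suc (suc k)) (acc rs) = begin
  2 + k                                 ≡⟨ cong (2 +_) (sym (⌊n/2⌋+⌈n/2⌉≡n k)) ⟩
  2 + (⌊ k /2⌋ + ⌈ k /2⌉)               ≤⟨ s≤s (s≤s (+-monoˡ-≤ ⌈ k /2⌉ (⌊n/2⌋≤⌈n/2⌉ k))) ⟩
  2 + (⌈ k /2⌉ + ⌈ k /2⌉)               ≡⟨ cong suc (sym (+-suc ⌈ k /2⌉ ⌈ k /2⌉)) ⟩
  suc ⌈ k /2⌉ + suc ⌈ k /2⌉             ≤⟨ +-mono-≤ ih ih ⟩
  2 ^ r + 2 ^ r                         ≡⟨ cong (2 ^ r +_) (sym (+-identityʳ (2 ^ r))) ⟩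
  2 ^ suc r                             ∎
  where
  open ≤-Reasoning
  r = ⌈log2⌉ (suc ⌈ k /2⌉) _
  ih = n≤2^⌈log2⌉ (suc ⌈ k /2⌉) _

n≤2^⌈log₂n⌉ : ∀ n → n ≤ 2 ^ ⌈log₂ n ⌉
n≤2^⌈log₂n⌉ n = n≤2^⌈log2⌉ n (<-wellFounded n)

mapMaybe-∷-just : ∀ {A B : Set} {f : A → Maybe B} {x : A} {y : B} (xs : List A) →
  f x ≡ just y → mapMaybe f (x ∷ xs) ≡ y ∷ mapMaybe f xs
mapMaybe-∷-just xs fx rewrite fx = refl

mapMaybe-unique : ∀ {A B : Set} {f : A → Maybe B} →
  (∀ {x y b} → f x ≡ just b → f y ≡ just b → x ≡ y) →
  ∀ {xs} → Unique xs → Unique (mapMaybe f xs)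
mapMaybe-unique         inj {[]}     []           = []
mapMaybe-unique {f = f} inj {x ∷ xs} (x∉xs ∷ xs!) with f x in fx
... | nothing = mapMaybe-unique inj xs!
... | just b  = All.mapMaybe⁺ (All.map⁺ (All.map distinct x∉xs)) ∷ mapMaybe-unique inj xs!
  where
  distinct : ∀ {y} → x ≢ y → Maybe.All (b ≢_) (f y)
  distinct {y} x≢y with f y in fy
  ... | nothing = Maybe.nothing
  ... | just c  = Maybe.just (λ { refl → x≢y (inj fx fy) })

adj-complete : ∀ {n} {u w : Fin n} → u ≢ w → adj (complete n) u w ≡ true
adj-complete u≢w = cong not (≟-≢ u≢w)

module CubeLists (n K : ℕ) (n≤2^K : n ≤ 2 ^ K) where

  encode : Fin n → Cube K
  encode u = bits K (toℕ u)

  value-encode : ∀ u → value (encode u) ≡ toℕ u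
  value-encode u = value-bits K (toℕ u) (<-≤-trans (toℕ<n u) n≤2^K)

  encode<n : ∀ u → value (encode u) < n
  encode<n u = subst (_< n) (sym (value-encode u)) (toℕ<n u)

  encode-injective : ∀ {u w} → encode u ≡ encode w → u ≡ w
  encode-injective {u} {w} eq =
    toℕ-injective (trans (sym (value-encode u)) (trans (cong value eq) (value-encode w)))

  encode-fromℕ< : ∀ {y} (y<n : value y < n) → encode (fromℕ< y<n) ≡ y
  encode-fromℕ< {y} y<n = trans (cong (bits K) (toℕ-fromℕ< y<n)) (bits-value y)

  decode : Cube K → Maybe (Fin n)
  decode y with value y <? n
  ... | yes y<n = just (fromℕ< y<n)
  ... | no  _   = nothing

  decode-All : ∀ {P : Fin n → Set} {y} → (∀ {u} → encode u ≡ y → P u) → Maybe.All P (decode y)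
  decode-All {y = y} p with value y <? n
  ... | yes y<n = Maybe.just (p (encode-fromℕ< y<n))
  ... | no  _   = Maybe.nothing

  decode-just : ∀ {y u} → decode y ≡ just u → encode u ≡ y
  decode-just {y} eq with value y <? n
  decode-just {y} refl | yes y<n = encode-fromℕ< y<n
  decode-just {y} ()   | no  _

  decode-encode : ∀ u → decode (encode u) ≡ just u
  decode-encode u with value (encode u) <? n
  ... | yes u<n = cong just (encode-injective (encode-fromℕ< u<n))
  ... | no  u≮n = ⊥-elim (u≮n (encode<n u))

  cubeLists : Lists n
  cubeLists v = mapMaybe decode (neighbours (encode v))

  cubeLists-valid : ValidLists (complete n) cubeLists
  cubeLists-valid v =
    mapMaybe-unique (λ p q → trans (sym (decode-just p)) (decode-just q)) (neighbours-unique (encode v)) ,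
    All.mapMaybe⁺ (All.map⁺ (All.map adjacent (neighbours-irreflexive (encode v))))
    where
    adjacent : ∀ {y} → encode v ≢ y → Maybe.All (λ u → adj (complete n) v u ≡ true) (decode y)
    adjacent v≢y = decode-All (λ u↦y → adj-complete (λ v≡u → v≢y (trans (cong encode v≡u) u↦y)))

  reached⇒informed : ∀ s t w → Reached (encode s) (encode w) t → informedAfter cubeLists s t w ≡ true
  reached⇒informed s zero    w w≡s = ≟-complete (encode-injective w≡s)
  reached⇒informed s (suc t) w r with Reached-step (encode s) (encode w) t r
  ... | inj₁ r′ = round-keeps cubeLists (informedAfter cubeLists s t) (reached⇒informed s t w r′)
  ... | inj₂ σ  = round-sends cubeLists (informedAfter cubeLists s t)
                    (mapMaybe decode before) (mapMaybe decode after)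
                    (informed (encode-fromℕ< sender<n) sender-reached) split
                    (All.mapMaybe⁺ (All.map⁺ (All.map (λ r′ → decode-All (λ u↦y → informed u↦y r′)) before-reached)))
    where
    open Sender σ
    informed : ∀ {u y} → encode u ≡ y → Reached (encode s) y t → informedAfter cubeLists s t u ≡ true
    informed refl = reached⇒informed s t _
    sender<n : value sender < n
    sender<n = ≤-<-trans sender-bounded (⊔-lub (encode<n s) (encode<n w))
    split : cubeLists (fromℕ< sender<n) ≡ mapMaybe decode before ++ w ∷ mapMaybe decode after
    split = begin
      mapMaybe decode (neighbours (encode (fromℕ< sender<n)))
        ≡⟨ cong (mapMaybe decode ∘ neighbours) (encode-fromℕ< {sender} sender<n) ⟩
      mapMaybe decode (neighbours sender)
        ≡⟨ cong (mapMaybe decode) neighbours-split ⟩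
      mapMaybe decode (before ++ encode w ∷ after)
        ≡⟨ mapMaybe-++ decode before (encode w ∷ after) ⟩
      mapMaybe decode before ++ mapMaybe decode (encode w ∷ after)
        ≡⟨ cong (mapMaybe decode before ++_) (mapMaybe-∷-just after (decode-encode w)) ⟩
      mapMaybe decode before ++ w ∷ mapMaybe decode after ∎
      where open ≡-Reasoning

  cubeLists-done : ∀ s → DoneAfter cubeLists s K
  cubeLists-done s w = reached⇒informed s K w (Reached-all (encode s) (encode w) K ≤-refl)

complete-connected : ∀ n → Connected (complete n)
complete-connected n u v with u ≟ v
... | yes refl = here
... | no  u≢v  = step (adj-complete u≢v) here

complete-broadcastTime : ∀ n → n ≥ 1 → BroadcastTimeFA (complete n) ⌈log₂ n ⌉
complete-broadcastTime n@(suc _) _ =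
  (cubeLists , cubeLists-valid , cubeLists-done) ,
  λ L _ → zero , λ t t<log done → <⇒≱ t<log (DoneAfter⇒⌈log₂⌉≤ L zero t done)
  where open CubeLists n ⌈log₂ n ⌉ (n≤2^⌈log₂n⌉ n)

theorem1 : ∀ (n : ℕ) → n ≥ 1 →
    (Σ (Graph n) λ G → Connected G × BroadcastTimeFA G ⌈log₂ n ⌉)
    × BroadcastTimeFA (complete n) ⌈log₂ n ⌉
theorem1 n n≥1 = (complete n , complete-connected n , Kₙ-optimal) , Kₙ-optimal
  where
  Kₙ-optimal : BroadcastTimeFA (complete n) ⌈log₂ n ⌉
  Kₙ-optimal = complete-broadcastTime n n≥1
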